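{- Let $G$ be a finite simple graph and $H$ a subgraph of $G$. Then for every positive integer $t$, $\left(tP_M(G)\right)|_H=tP_M(H)$.
   Context: For a graph $G$ with edge set $E$, the matching polytope $P_M(G)\subset\mathbb{R}^E$ is the convex hull of the indicator vectors of all matchings of $G$. For $x\in\mathbb{R}^{E(G)}$, $x|_H\in\mathbb{R}^{E(H)}$ denotes its restriction to the coordinates indexed by $E(H)$, and for $X\subseteq\mathbb{R}^{E(G)}$, $X|_H=\{x|_H:x\in X\}$.
   Formalization: The matching polytopes $P_M(G)$ and $P_M(H)$ and their dilates are taken over ℚ rather than ℝ: points have rational coordinates and are convex combinations with rational weights. -}

module Defs where

open import Data.Nat using (ℕ)
open import Data.Fin using (Fin)
open import Data.Bool using (Bool; true; false)
open import Data.Integer using (+_)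
open import Data.Rational using (ℚ; _/_; 0ℚ; 1ℚ; _+_; _*_; _≤_)
open import Data.List using (List; []; _∷_; map; foldr)
open import Data.Product using (Σ; _×_; _,_; proj₁; proj₂; ∃)
open import Data.Sum using (_⊎_)
open import Data.Empty using (⊥)
open import Relation.Nullary using (¬_)
open import Relation.Binary.PropositionalEquality using (_≡_; _≢_)
open import Function.Bundles using (_⇔_)
open import Function.Definitions using (Injective)

SameEnds : ∀ {n} → Fin n × Fin n → Fin n × Fin n → Set
SameEnds (a , b) (c , d) = (a ≡ c × b ≡ d) ⊎ (a ≡ d × b ≡ c)

record Graph : Set where
  field
    nV    : ℕ
    nE    : ℕ
    ends  : Fin nE → Fin nV × Fin nV
    loopless : ∀ e → proj₁ (ends e) ≢ proj₂ (ends e)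
    noMulti  : ∀ e f → SameEnds (ends e) (ends f) → e ≡ f
open Graph public

Vect : Graph → Set
Vect G = Fin (nE G) → ℚ

Incident : (G : Graph) → Fin (nV G) → Fin (nE G) → Set
Incident G v e = (v ≡ proj₁ (ends G e)) ⊎ (v ≡ proj₂ (ends G e))

IsMatching : (G : Graph) → (Fin (nE G) → Bool) → Set
IsMatching G M = ∀ e f → M e ≡ true → M f ≡ true → e ≢ f →
  ∀ v → ¬ (Incident G v e × Incident G v f)

Matching : Graph → Set
Matching G = Σ (Fin (nE G) → Bool) (IsMatching G)

indicator : (G : Graph) → Matching G → Vect G
indicator G (M , _) e with M e
... | true  = 1ℚ
... | false = 0ℚ

sumℚ : List ℚ → ℚ
sumℚ = foldr _+_ 0ℚ

InConvexHull : {I : Set} {m : ℕ} → (I → Fin m → ℚ) → (Fin m → ℚ) → Set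
InConvexHull {I} p x =
  Σ (List (ℚ × I)) λ c →
    (∀ {w i} → (w , i) ∈ₗ c → 0ℚ ≤ w) ×
    (sumℚ (map proj₁ c) ≡ 1ℚ) ×
    (∀ k → x k ≡ sumℚ (map (λ wi → proj₁ wi * p (proj₂ wi) k) c))
  where
  open import Data.List.Membership.Propositional renaming (_∈_ to _∈ₗ_)

InPM : (G : Graph) → Vect G → Set
InPM G x = InConvexHull (indicator G) x

ℕtoℚ : ℕ → ℚ
ℕtoℚ t = + t / 1

Scale : {m : ℕ} → ℕ → ((Fin m → ℚ) → Set) → (Fin m → ℚ) → Set
Scale {m} t X x = Σ (Fin m → ℚ) λ y → X y × (∀ k → x k ≡ ℕtoℚ t * y k)

record Subgraph (H G : Graph) : Set where
  field
    vmap : Fin (nV H) → Fin (nV G)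
    emap : Fin (nE H) → Fin (nE G)
    vmap-inj : Injective _≡_ _≡_ vmap
    emap-inj : Injective _≡_ _≡_ emap
    ends-compat : ∀ e → SameEnds (ends G (emap e))
                          (vmap (proj₁ (ends H e)) , vmap (proj₂ (ends H e)))
open Subgraph public

restrict : {H G : Graph} → Subgraph H G → Vect G → Vect H
restrict S x e = x (emap S e)

Restrict : {H G : Graph} → Subgraph H G → (Vect G → Set) → Vect H → Set
Restrict {H} {G} S X x = Σ (Vect G) λ y → X y × (∀ e → restrict S y e ≡ x e)

{-# OPTIONS --safe #-}
module Submission where

-- Restricting a matching of G to E(H) gives a matching of H, and extending a
-- matching of H by no further edges gives a matching of G whose restriction is
-- the original one.  Restriction of indicator vectors is linear, so convex
-- combinations move across in both directions, and it commutes with scaling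
-- by t.

open import Defs
open import Data.Nat using (ℕ; _≥_)
open import Function.Base using (_∘_)
open import Function.Bundles using (_⇔_; mk⇔; Equivalence)
open import Function.Construct.Composition using (_⇔-∘_)
open import Data.Fin using (Fin; _≟_)
open import Data.Fin.Properties using (any?)
open import Data.Bool using (Bool; true; false)
open import Data.Rational using (ℚ; 0ℚ; 1ℚ; _*_; _≤_)
open import Data.List using (List; map)
open import Data.List.Properties using (map-cong; map-∘)
open import Data.List.Membership.Propositional using (_∈_)
open import Data.List.Membership.Propositional.Properties using (∈-map⁻)
open import Data.Product using (_×_; _,_; proj₁; proj₂; ∃; map₂)
open import Data.Sum using (inj₁; inj₂)
open import Relation.Nullary using (yes; no; contradiction)
open import Relation.Binary.PropositionalEquality

combination : {I : Set} {m : ℕ} → (I → Fin m → ℚ) → List (ℚ × I) → Fin m → ℚ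
combination p c k = sumℚ (map (λ wi → proj₁ wi * p (proj₂ wi) k) c)

combination-cong : {I : Set} {m n : ℕ} (p : I → Fin m → ℚ) (q : I → Fin n → ℚ)
  (c : List (ℚ × I)) {k : Fin m} {k′ : Fin n} →
  (∀ i → p i k ≡ q i k′) → combination p c k ≡ combination q c k′
combination-cong p q c eq =
  cong sumℚ (map-cong (λ wi → cong (proj₁ wi *_) (eq (proj₂ wi))) c)

InConvexHull-resp-≗ : {I : Set} {m : ℕ} {p : I → Fin m → ℚ} {x y : Fin m → ℚ} →
  (∀ k → x k ≡ y k) → InConvexHull p x → InConvexHull p y
InConvexHull-resp-≗ x≗y (c , nonneg , total , x≡) =
  c , nonneg , total , λ k → trans (sym (x≗y k)) (x≡ k)

InConvexHull-∘ : {I J : Set} {m : ℕ} (p : J → Fin m → ℚ) (φ : I → J) (c : List (ℚ × I)) →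
  (∀ {w i} → (w , i) ∈ c → 0ℚ ≤ w) → sumℚ (map proj₁ c) ≡ 1ℚ →
  InConvexHull p (combination (p ∘ φ) c)
InConvexHull-∘ p φ c nonneg total =
  map (map₂ φ) c , nonneg′ , trans (cong sumℚ (sym (map-∘ c))) total ,
  λ k → cong sumℚ (map-∘ c)
  where
  nonneg′ : ∀ {w j} → (w , j) ∈ map (map₂ φ) c → 0ℚ ≤ w
  nonneg′ w∈ with ∈-map⁻ (map₂ φ) w∈
  ... | _ , wi∈c , refl = nonneg wi∈c

Scale-cong : {m : ℕ} {X Y : (Fin m → ℚ) → Set} (t : ℕ) →
  (∀ y → X y ⇔ Y y) → ∀ x → Scale t X x ⇔ Scale t Y x
Scale-cong t X⇔Y x = mk⇔
  (λ (y , Xy , x≡) → y , Equivalence.to (X⇔Y y) Xy , x≡)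
  (λ (y , Yy , x≡) → y , Equivalence.from (X⇔Y y) Yy , x≡)

Restrict-Scale : {H G : Graph} (S : Subgraph H G) (t : ℕ) (X : Vect G → Set) →
  ∀ x → Restrict S (Scale t X) x ⇔ Scale t (Restrict S X) x
Restrict-Scale S t X x = mk⇔
  (λ (y , (z , Xz , y≡) , y|≡x) →
    restrict S z , (z , Xz , λ _ → refl) , λ e → trans (sym (y|≡x e)) (y≡ (emap S e)))
  (λ (z , (y , Xy , y|≡z) , x≡) →
    (λ k → ℕtoℚ t * y k) , (y , Xy , λ _ → refl) ,
    λ e → trans (cong (ℕtoℚ t *_) (y|≡z e)) (sym (x≡ e)))

indicator-cong : (G H : Graph) (M : Matching G) (N : Matching H) {k : Fin (nE G)} {e : Fin (nE H)} →
  proj₁ M k ≡ proj₁ N e → indicator G M k ≡ indicator H N e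
indicator-cong G H (M , _) (N , _) {k} {e} eq with M k | N e | eq
... | true  | _ | refl = refl
... | false | _ | refl = refl

module _ {H G : Graph} (S : Subgraph H G) where

  Incident-map : ∀ {v e} → Incident H v e → Incident G (vmap S v) (emap S e)
  Incident-map {e = e} v∈e with ends-compat S e | v∈e
  ... | inj₁ (p , q) | inj₁ r = inj₁ (trans (cong (vmap S) r) (sym p))
  ... | inj₁ (p , q) | inj₂ r = inj₂ (trans (cong (vmap S) r) (sym q))
  ... | inj₂ (p , q) | inj₁ r = inj₂ (trans (cong (vmap S) r) (sym q))
  ... | inj₂ (p , q) | inj₂ r = inj₁ (trans (cong (vmap S) r) (sym p))

  Incident-map⁻ : ∀ {w e} → Incident G w (emap S e) → ∃ λ u → vmap S u ≡ w × Incident H u e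
  Incident-map⁻ {e = e} w∈e with ends-compat S e | w∈e
  ... | inj₁ (p , q) | inj₁ r = _ , sym (trans r p) , inj₁ refl
  ... | inj₁ (p , q) | inj₂ r = _ , sym (trans r q) , inj₂ refl
  ... | inj₂ (p , q) | inj₁ r = _ , sym (trans r p) , inj₂ refl
  ... | inj₂ (p , q) | inj₂ r = _ , sym (trans r q) , inj₁ refl

  restrictMatching : Matching G → Matching H
  restrictMatching (M , isM) = M ∘ emap S ,
    λ e f e∈M f∈M e≢f v (v∈e , v∈f) →
      isM (emap S e) (emap S f) e∈M f∈M (e≢f ∘ emap-inj S) (vmap S v)
          (Incident-map v∈e , Incident-map v∈f)

  extendEdges : (Fin (nE H) → Bool) → Fin (nE G) → Bool
  extendEdges M f with any? (λ e → emap S e ≟ f)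
  ... | yes (e , _) = M e
  ... | no _        = false

  extendEdges-emap : ∀ M e → extendEdges M (emap S e) ≡ M e
  extendEdges-emap M e with any? (λ e′ → emap S e′ ≟ emap S e)
  ... | yes (e′ , eq) = cong M (emap-inj S eq)
  ... | no ∄e         = contradiction (e , refl) ∄e

  extendEdges-true : ∀ M f → extendEdges M f ≡ true → ∃ λ e → emap S e ≡ f × M e ≡ true
  extendEdges-true M f f∈M with any? (λ e → emap S e ≟ f)
  ... | yes (e , eq) = e , eq , f∈M
  extendEdges-true M f () | no _

  extendMatching : Matching H → Matching G
  extendMatching (M , isM) = extendEdges M , isM′
    where
    isM′ : IsMatching G (extendEdges M)
    isM′ f₁ f₂ f₁∈M f₂∈M f₁≢f₂ w (w∈f₁ , w∈f₂)
      with extendEdges-true M f₁ f₁∈M | extendEdges-true M f₂ f₂∈M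
    ... | e₁ , refl , e₁∈M | e₂ , refl , e₂∈M
      with Incident-map⁻ w∈f₁ | Incident-map⁻ w∈f₂
    ... | u₁ , refl , u₁∈e₁ | u₂ , u₂↦w , u₂∈e₂
      with vmap-inj S u₂↦w
    ... | refl = isM e₁ e₂ e₁∈M e₂∈M (f₁≢f₂ ∘ cong (emap S)) u₁ (u₁∈e₁ , u₂∈e₂)

  indicator-restrictMatching : ∀ M e →
    indicator H (restrictMatching M) e ≡ indicator G M (emap S e)
  indicator-restrictMatching M e = indicator-cong H G (restrictMatching M) M refl

  indicator-extendMatching : ∀ N e →
    indicator G (extendMatching N) (emap S e) ≡ indicator H N e
  indicator-extendMatching N e =
    indicator-cong G H (extendMatching N) N (extendEdges-emap (proj₁ N) e)

  Restrict-InPM : ∀ x → Restrict S (InPM G) x ⇔ InPM H x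
  Restrict-InPM x = mk⇔
    (λ (y , (c , nonneg , total , y≡) , y|≡x) →
      InConvexHull-resp-≗
        (λ e → trans (combination-cong (indicator H ∘ restrictMatching) (indicator G) c
                                       (λ M → indicator-restrictMatching M e))
                     (trans (sym (y≡ (emap S e))) (y|≡x e)))
        (InConvexHull-∘ (indicator H) restrictMatching c nonneg total))
    (λ (c , nonneg , total , x≡) →
      combination (indicator G ∘ extendMatching) c ,
      InConvexHull-∘ (indicator G) extendMatching c nonneg total ,
      λ e → trans (combination-cong (indicator G ∘ extendMatching) (indicator H) c
                                    (λ N → indicator-extendMatching N e))
                  (sym (x≡ e)))

lemma3p6 : (G H : Graph) (S : Subgraph H G) (t : ℕ) → t ≥ 1 →
    ∀ (x : Vect H) → Restrict S (Scale t (InPM G)) x ⇔ Scale t (InPM H) x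
lemma3p6 G H S t _ x = Scale-cong t (Restrict-InPM S) x ⇔-∘ Restrict-Scale S t (InPM G) x
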